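{- Let $a,b_1,b_2,c\in\mathbb{Z}$ with $a\geq 1$, and let $f=ax_1x_2+b_1x_1+b_2x_2+c\in\mathbb{Z}[x_1,x_2]$. Put $d_1^{+}=\max\big(1,\lceil\frac{1-b_2}{a}\rceil\big)$ and $d_2^{+}=\max\big(1,\lceil\frac{1-b_1}{a}\rceil\big)$. Then \[ \min \mathcal{D}_{\geq 0}(f)=\min \left\{ \left(d,\max\Big(d_2^+,\Big\lceil \frac{ -(c+b_1d)}{ad+b_2}\Big\rceil \Big)\right) \Big|\, d\in\mathbb{N}_+,\ d_1^{+} \leq d\leq \max \Big(d_1^+,\Big\lceil \frac{ -(c+b_2d_2^{+} )}{ad_2^{+} +b_1 } \Big\rceil \Big) \right\}. \]
   Context: $\mathbb{N}_+$ denotes the positive integers. On $\mathbb{R}^n$ we use the componentwise partial order: $\mathbf{a}\leq\mathbf{b}$ iff $a_i\leq b_i$ for all $i$; for a set $A\subseteq\mathbb{N}^n$, $\min A$ denotes the set of minimal elements of $A$ under this order. For a polynomial $f\in\mathbb{Z}[x_1,\dots,x_n]$ and $\mathbf{d}\in\mathbb{Z}^n$, write $f_{\mathbf{d}}(X)=f(X+\mathbf{d})=f(x_1+d_1,\dots,x_n+d_n)$. Define $\mathcal{D}_{\geq 0}(f)=\{\mathbf{d}\in\mathbb{N}_+^n : \text{all non-constant coefficients of } f_{\mathbf{d}}(X) \text{ are positive and } f(\mathbf{d})\geq 0\}$. -}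

module Defs where

open import Level using (0ℓ)
open import Data.Nat as ℕ using (ℕ; zero; suc)
open import Data.Integer using (ℤ; +_; -[1+_]; _+_; _*_; -_; _≤_; _<_; _⊔_)
open import Data.Product using (_×_; _,_; proj₁; proj₂; ∃-syntax)
open import Relation.Unary using (Pred)
open import Relation.Binary.PropositionalEquality using (_≡_)

-- Ceiling of the rational x / y, for y > 0 (y = + suc m).
-- For y ≤ 0 it returns the junk value 0; in the statement it is only
-- ever applied to positive divisors.
⌈_/_⌉ : ℤ → ℤ → ℤ
⌈ + n      / + suc m ⌉ = + ((n ℕ.+ m) ℕ./ suc m)
⌈ -[1+ n ] / + suc m ⌉ = - (+ (suc n ℕ./ suc m))
⌈ _        / _       ⌉ = + 0

record Poly : Set where
  constructor poly
  field
    coef₁₂ : ℤ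
    coef₁  : ℤ
    coef₂  : ℤ
    coef₀  : ℤ
open Poly public

Point : Set
Point = ℤ × ℤ

eval : Poly → Point → ℤ
eval (poly a b₁ b₂ c) (x₁ , x₂) = a * x₁ * x₂ + b₁ * x₁ + b₂ * x₂ + c

-- shifted polynomial f_d(X) = f(X + d), expanded:
-- a(x₁+d₁)(x₂+d₂) + b₁(x₁+d₁) + b₂(x₂+d₂) + c
--   = a x₁x₂ + (a d₂ + b₁) x₁ + (a d₁ + b₂) x₂ + f(d)
shift : Poly → Point → Poly
shift f@(poly a b₁ b₂ c) d@(d₁ , d₂) =
  poly a (a * d₂ + b₁) (a * d₁ + b₂) (eval f d)

NonConstPos : Poly → Set
NonConstPos (poly a b₁ b₂ c) = (+ 0 < a) × (+ 0 < b₁) × (+ 0 < b₂)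

_≤²_ : Point → Point → Set
(x₁ , x₂) ≤² (y₁ , y₂) = (x₁ ≤ y₁) × (x₂ ≤ y₂)

Min : Pred Point 0ℓ → Pred Point 0ℓ
Min A p = A p × (∀ q → A q → q ≤² p → q ≡ p)

D≥0 : Poly → Pred Point 0ℓ
D≥0 f d@(d₁ , d₂) =
  (+ 1 ≤ d₁) × (+ 1 ≤ d₂) × NonConstPos (shift f d) × (+ 0 ≤ eval f d)

d₁⁺ : Poly → ℤ
d₁⁺ (poly a b₁ b₂ c) = + 1 ⊔ ⌈ + 1 + - b₂ / a ⌉

d₂⁺ : Poly → ℤ
d₂⁺ (poly a b₁ b₂ c) = + 1 ⊔ ⌈ + 1 + - b₁ / a ⌉

Cand : Poly → Pred Point 0ℓ
Cand f@(poly a b₁ b₂ c) p =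
  ∃[ d ] ( (+ 1 ≤ d)
         × (d₁⁺ f ≤ d)
         × (d ≤ d₁⁺ f ⊔ ⌈ - (c + b₂ * d₂⁺ f) / a * d₂⁺ f + b₁ ⌉)
         × (p ≡ (d , d₂⁺ f ⊔ ⌈ - (c + b₁ * d) / a * d + b₂ ⌉)) )

{-# OPTIONS --safe #-}
-- A point d ∈ ℕ₊² lies in 𝒟_{≥0}(f) iff d₁ ≥ d₁⁺ (positivity of the x₂-coefficient
-- a d₁ + b₂) and d₂ ≥ g(d₁), where g(d) = max(d₂⁺, ⌈-(c + b₁ d)/(a d + b₂)⌉)
-- collects positivity of the x₁-coefficient and f(d) ≥ 0, the latter being
-- linear in d₂ with positive slope.  So 𝒟_{≥0}(f) is the region above the graph
-- of g over [d₁⁺, ∞), and its minimal points lie on that graph.  Moreover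
-- g attains its least value d₂⁺ at M = max(d₁⁺, ⌈-(c + b₂ d₂⁺)/(a d₂⁺ + b₁)⌉),
-- by the same computation with the roles of the variables exchanged; a point of
-- the graph beyond M is dominated by (M, g(M)), so only d ∈ [d₁⁺, M] can occur.
module Submission where

open import Level using (0ℓ)
open import Data.Nat as ℕ using (suc)
import Data.Nat.Properties as ℕ
open import Data.Nat.DivMod using (m≡m%n+[m/n]*n; m%n<n)
open import Data.Integer
  using (ℤ; +_; -[1+_]; _+_; _-_; _*_; -_; _≤_; _<_; _⊔_; +<+) renaming (suc to sucℤ)
open import Data.Integer.Properties
open import Data.Integer.Tactic.RingSolver using (solve-∀)
open import Data.Product using (_×_; _,_; proj₁; proj₂; ∃-syntax)
open import Function.Base using (_∘_)
open import Function.Bundles using (_⇔_; mk⇔; Equivalence)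
open import Relation.Binary.PropositionalEquality
open import Relation.Unary using (Pred; _⊆_; _≐_)
open import Relation.Unary.Properties using (≐-sym)

open import Defs

open Equivalence using (to; from)

⌈/⌉-spec : ∀ x m → ∃[ r ] (r ℕ.≤ m × ⌈ x / + suc m ⌉ * + suc m ≡ x + + r)
⌈/⌉-spec (+ n) m = m ℕ.∸ r , ℕ.m∸n≤m m r , (begin
    + q * + suc m        ≡⟨ pos-* q (suc m) ⟨
    + (q ℕ.* suc m)      ≡⟨ cong +_ q*m≡n+m∸r ⟩
    + (n ℕ.+ (m ℕ.∸ r))  ≡⟨ pos-+ n (m ℕ.∸ r) ⟩
    + n + + (m ℕ.∸ r)    ∎)
  where
  open ≡-Reasoning
  q = (n ℕ.+ m) ℕ./ suc m
  r = (n ℕ.+ m) ℕ.% suc m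
  q*m≡n+m∸r : q ℕ.* suc m ≡ n ℕ.+ (m ℕ.∸ r)
  q*m≡n+m∸r = ℕ.+-cancelʳ-≡ r _ _ (begin
    q ℕ.* suc m ℕ.+ r      ≡⟨ ℕ.+-comm (q ℕ.* suc m) r ⟩
    r ℕ.+ q ℕ.* suc m      ≡⟨ m≡m%n+[m/n]*n (n ℕ.+ m) (suc m) ⟨
    n ℕ.+ m                ≡⟨ cong (n ℕ.+_) (ℕ.m∸n+n≡m (ℕ.≤-pred (m%n<n (n ℕ.+ m) (suc m)))) ⟨
    n ℕ.+ (m ℕ.∸ r ℕ.+ r)  ≡⟨ ℕ.+-assoc n (m ℕ.∸ r) r ⟨
    n ℕ.+ (m ℕ.∸ r) ℕ.+ r  ∎)
⌈/⌉-spec -[1+ n ] m = r , ℕ.≤-pred (m%n<n (suc n) (suc m)) , (begin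
    - + q * + suc m                ≡⟨ negate-sum (+ q) (+ suc m) (+ r) ⟩
    - (+ r + + q * + suc m) + + r  ≡⟨ cong (λ z → - z + + r) n+1≡r+q*m ⟨
    -[1+ n ] + + r                 ∎)
  where
  open ≡-Reasoning
  q = suc n ℕ./ suc m
  r = suc n ℕ.% suc m
  n+1≡r+q*m : + suc n ≡ + r + + q * + suc m
  n+1≡r+q*m = begin
    + suc n                 ≡⟨ cong +_ (m≡m%n+[m/n]*n (suc n) (suc m)) ⟩
    + (r ℕ.+ q ℕ.* suc m)   ≡⟨ pos-+ r (q ℕ.* suc m) ⟩
    + r + + (q ℕ.* suc m)   ≡⟨ cong (λ z → + r + z) (pos-* q (suc m)) ⟩
    + r + + q * + suc m     ∎
  negate-sum : ∀ q y r → - q * y ≡ - (r + q * y) + r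
  negate-sum = solve-∀

⌈/⌉≤⇔≤* : ∀ {x y k} → + 0 < y → (⌈ x / y ⌉ ≤ k) ⇔ (x ≤ k * y)
⌈/⌉≤⇔≤* {y = + 0}      (+<+ ())
⌈/⌉≤⇔≤* {y = -[1+ _ ]} ()
⌈/⌉≤⇔≤* {x} {+ suc m} {k} _ with ⌈/⌉-spec x m
... | r , r≤m , ⌈x/y⌉*y≡x+r = mk⇔ upper lower
  where
  y = + suc m
  upper : ⌈ x / y ⌉ ≤ k → x ≤ k * y
  upper ⌈x/y⌉≤k = begin
    x              ≤⟨ i≤i+j x (+ r) ⟩
    x + + r        ≡⟨ ⌈x/y⌉*y≡x+r ⟨
    ⌈ x / y ⌉ * y  ≤⟨ *-monoʳ-≤-nonNeg y ⌈x/y⌉≤k ⟩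
    k * y          ∎
    where open ≤-Reasoning
  lower : x ≤ k * y → ⌈ x / y ⌉ ≤ k
  lower x≤k*y = ≮⇒≥ λ k<⌈x/y⌉ → <-irrefl refl (begin-strict
    sucℤ k * y     ≤⟨ *-monoʳ-≤-nonNeg y (i<j⇒suc[i]≤j k<⌈x/y⌉) ⟩
    ⌈ x / y ⌉ * y  ≡⟨ ⌈x/y⌉*y≡x+r ⟩
    x + + r        <⟨ +-mono-≤-< x≤k*y (+<+ (ℕ.s≤s r≤m)) ⟩
    k * y + y      ≡⟨ suc-*-comm k y ⟨
    sucℤ k * y     ∎)
    where
    open ≤-Reasoning
    suc-*-comm : ∀ k y → (+ 1 + k) * y ≡ k * y + y
    suc-*-comm = solve-∀

i≤j+k⇔i-k≤j : ∀ i j k → (i ≤ j + k) ⇔ (i - k ≤ j)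
i≤j+k⇔i-k≤j i j k = mk⇔
  (λ i≤j+k → subst (i - k ≤_) (+-k-cancel j k) (+-monoˡ-≤ (- k) i≤j+k))
  (λ i-k≤j → subst (_≤ j + k) (-k+-cancel i k) (+-monoˡ-≤ k i-k≤j))
  where
  +-k-cancel : ∀ j k → j + k - k ≡ j
  +-k-cancel = solve-∀
  -k+-cancel : ∀ i k → i - k + k ≡ i
  -k+-cancel = solve-∀

0<a*x+b⇔1-b≤x*a : ∀ a x b → (+ 0 < a * x + b) ⇔ (+ 1 - b ≤ x * a)
0<a*x+b⇔1-b≤x*a a x b = mk⇔
  (λ 0<ax+b → subst (+ 1 - b ≤_) (*-comm a x) (to (i≤j+k⇔i-k≤j _ _ b) (i<j⇒suc[i]≤j 0<ax+b)))
  (λ 1-b≤xa → suc[i]≤j⇒i<j (from (i≤j+k⇔i-k≤j _ _ b) (subst (+ 1 - b ≤_) (*-comm x a) 1-b≤xa)))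

1⊔⌈1-b/a⌉≤⇔ : ∀ {a b x} → + 0 < a →
  (+ 1 ⊔ ⌈ + 1 - b / a ⌉ ≤ x) ⇔ (+ 1 ≤ x × + 0 < a * x + b)
1⊔⌈1-b/a⌉≤⇔ {a} {b} {x} 0<a = mk⇔
  (λ ≤x → i⊔j≤k⇒i≤k (+ 1) _ ≤x ,
           from (0<a*x+b⇔1-b≤x*a a x b) (to (⌈/⌉≤⇔≤* 0<a) (i⊔j≤k⇒j≤k (+ 1) _ ≤x)))
  (λ (1≤x , 0<ax+b) → ⊔-lub 1≤x (from (⌈/⌉≤⇔≤* 0<a) (to (0<a*x+b⇔1-b≤x*a a x b) 0<ax+b)))

⌈-v/u⌉≤⇔0≤t*u+v : ∀ {u v t} → + 0 < u → (⌈ - v / u ⌉ ≤ t) ⇔ (+ 0 ≤ t * u + v)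
⌈-v/u⌉≤⇔0≤t*u+v {u} {v} {t} 0<u = mk⇔
  (λ ≤t → from (i≤j+k⇔i-k≤j _ _ v) (subst (_≤ t * u) (sym (+-identityˡ (- v))) (to (⌈/⌉≤⇔≤* 0<u) ≤t)))
  (λ 0≤ → from (⌈/⌉≤⇔≤* 0<u) (subst (_≤ t * u) (+-identityˡ (- v)) (to (i≤j+k⇔i-k≤j _ _ v) 0≤)))

Epigraph : ℤ → (ℤ → ℤ) → Pred Point 0ℓ
Epigraph l g (x , y) = l ≤ x × g x ≤ y

Graph : ℤ → ℤ → (ℤ → ℤ) → Pred Point 0ℓ
Graph l u g p = ∃[ d ] (l ≤ d × d ≤ u × p ≡ (d , g d))

Min-resp-≐ : ∀ {A B : Pred Point 0ℓ} → A ≐ B → Min A ⊆ Min B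
Min-resp-≐ (A⊆B , B⊆A) (Ap , minimal) = A⊆B Ap , λ q Bq q≤p → minimal q (B⊆A Bq) q≤p

module _ {l u : ℤ} {g : ℤ → ℤ} where

  Graph⊆Epigraph : Graph l u g ⊆ Epigraph l g
  Graph⊆Epigraph (d , l≤d , _ , refl) = l≤d , ≤-refl

  Min-Epigraph⊆Min-Graph : l ≤ u → (∀ x → l ≤ x → g u ≤ g x) →
    Min (Epigraph l g) ⊆ Min (Graph l u g)
  Min-Epigraph⊆Min-Graph l≤u gu-least {x , y} ((l≤x , gx≤y) , minimal) =
      (x , l≤x , x≤u , cong (x ,_) (sym gx≡y))
    , λ q Gq q≤p → minimal q (Graph⊆Epigraph Gq) q≤p
    where
    gx≡y : g x ≡ y
    gx≡y = cong proj₂ (minimal (x , g x) (l≤x , ≤-refl) (≤-refl , gx≤y))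
    x≤u : x ≤ u
    x≤u = ≮⇒≥ λ u<x → <-irrefl
      (cong proj₁ (minimal (u , y) (l≤u , ≤-trans (gu-least x l≤x) gx≤y) (<⇒≤ u<x , ≤-refl)))
      u<x

  Min-Graph⊆Min-Epigraph : Min (Graph l u g) ⊆ Min (Epigraph l g)
  Min-Graph⊆Min-Epigraph {p} (Gp@(d , _ , d≤u , refl) , minimal) =
    Graph⊆Epigraph Gp , dominated
    where
    dominated : ∀ q → Epigraph l g q → q ≤² (d , g d) → q ≡ (d , g d)
    dominated (x , y) (l≤x , gx≤y) (x≤d , y≤gd) =
      cong₂ _,_ (cong proj₁ x,gx≡p) (≤-antisym y≤gd (subst (_≤ y) (cong proj₂ x,gx≡p) gx≤y))
      where
      x,gx≡p : (x , g x) ≡ (d , g d)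
      x,gx≡p = minimal (x , g x) (x , l≤x , ≤-trans x≤d d≤u , refl) (x≤d , ≤-trans gx≤y y≤gd)

-- least₂ and last₁ are the g and M above.
module Bilinear (a b₁ b₂ c : ℤ) (0<a : + 0 < a) where

  private
    f : Poly
    f = poly a b₁ b₂ c

  least₂ : ℤ → ℤ
  least₂ d = d₂⁺ f ⊔ ⌈ - (c + b₁ * d) / a * d + b₂ ⌉

  last₁ : ℤ
  last₁ = d₁⁺ f ⊔ ⌈ - (c + b₂ * d₂⁺ f) / a * d₂⁺ f + b₁ ⌉

  eval-linear₂ : ∀ x y → eval f (x , y) ≡ y * (a * x + b₂) + (c + b₁ * x)
  eval-linear₂ x y = expand a b₁ b₂ c x y
    where
    expand : ∀ a b₁ b₂ c x y → a * x * y + b₁ * x + b₂ * y + c ≡ y * (a * x + b₂) + (c + b₁ * x)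
    expand = solve-∀

  eval-linear₁ : ∀ x y → eval f (x , y) ≡ x * (a * y + b₁) + (c + b₂ * y)
  eval-linear₁ x y = expand a b₁ b₂ c x y
    where
    expand : ∀ a b₁ b₂ c x y → a * x * y + b₁ * x + b₂ * y + c ≡ x * (a * y + b₁) + (c + b₂ * y)
    expand = solve-∀

  D≥0≐Epigraph : D≥0 f ≐ Epigraph (d₁⁺ f) least₂
  D≥0≐Epigraph = D≥0⊆Epigraph , Epigraph⊆D≥0
    where
    D≥0⊆Epigraph : D≥0 f ⊆ Epigraph (d₁⁺ f) least₂
    D≥0⊆Epigraph {x , y} (1≤x , 1≤y , (_ , 0<ay+b₁ , 0<ax+b₂) , 0≤f) =
        from (1⊔⌈1-b/a⌉≤⇔ 0<a) (1≤x , 0<ax+b₂)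
      , ⊔-lub (from (1⊔⌈1-b/a⌉≤⇔ 0<a) (1≤y , 0<ay+b₁))
              (from (⌈-v/u⌉≤⇔0≤t*u+v 0<ax+b₂) (subst (+ 0 ≤_) (eval-linear₂ x y) 0≤f))
    Epigraph⊆D≥0 : Epigraph (d₁⁺ f) least₂ ⊆ D≥0 f
    Epigraph⊆D≥0 {x , y} (d₁⁺≤x , least₂≤y)
      with to (1⊔⌈1-b/a⌉≤⇔ 0<a) d₁⁺≤x | to (1⊔⌈1-b/a⌉≤⇔ 0<a) (i⊔j≤k⇒i≤k _ _ least₂≤y)
    ... | 1≤x , 0<ax+b₂ | 1≤y , 0<ay+b₁ =
      1≤x , 1≤y , (0<a , 0<ay+b₁ , 0<ax+b₂) ,
      subst (+ 0 ≤_) (sym (eval-linear₂ x y)) (to (⌈-v/u⌉≤⇔0≤t*u+v 0<ax+b₂) (i⊔j≤k⇒j≤k _ _ least₂≤y))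

  Cand≐Graph : Cand f ≐ Graph (d₁⁺ f) last₁ least₂
  Cand≐Graph = (λ (d , _ , d₁⁺≤d , d≤last₁ , p≡) → d , d₁⁺≤d , d≤last₁ , p≡)
             , (λ (d , d₁⁺≤d , d≤last₁ , p≡) → d , i⊔j≤k⇒i≤k _ _ d₁⁺≤d , d₁⁺≤d , d≤last₁ , p≡)

  least₂[last₁]≤d₂⁺ : least₂ last₁ ≤ d₂⁺ f
  least₂[last₁]≤d₂⁺ =
    ⊔-lub ≤-refl (from (⌈-v/u⌉≤⇔0≤t*u+v 0<a*last₁+b₂) (subst (+ 0 ≤_) (eval-linear₂ last₁ (d₂⁺ f)) 0≤f))
    where
    0<a*d₂⁺+b₁ : + 0 < a * d₂⁺ f + b₁
    0<a*d₂⁺+b₁ = proj₂ (to (1⊔⌈1-b/a⌉≤⇔ 0<a) ≤-refl)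
    0<a*last₁+b₂ : + 0 < a * last₁ + b₂
    0<a*last₁+b₂ = proj₂ (to (1⊔⌈1-b/a⌉≤⇔ 0<a) (i≤i⊔j _ _))
    0≤f : + 0 ≤ eval f (last₁ , d₂⁺ f)
    0≤f = subst (+ 0 ≤_) (sym (eval-linear₁ last₁ (d₂⁺ f)))
            (to (⌈-v/u⌉≤⇔0≤t*u+v 0<a*d₂⁺+b₁) (i≤j⊔i (d₁⁺ f) _))

  least₂[last₁]≤least₂ : ∀ x → least₂ last₁ ≤ least₂ x
  least₂[last₁]≤least₂ x = ≤-trans least₂[last₁]≤d₂⁺ (i≤i⊔j _ _)

lemma2p5 : (a b₁ b₂ c : ℤ) → + 1 ≤ a →
    ∀ p → Min (D≥0 (poly a b₁ b₂ c)) p ⇔ Min (Cand (poly a b₁ b₂ c)) p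
lemma2p5 a b₁ b₂ c 1≤a p = mk⇔
  (Min-resp-≐ (≐-sym Cand≐Graph)
    ∘ Min-Epigraph⊆Min-Graph (i≤i⊔j _ _) (λ x _ → least₂[last₁]≤least₂ x)
    ∘ Min-resp-≐ D≥0≐Epigraph)
  (Min-resp-≐ (≐-sym D≥0≐Epigraph)
    ∘ Min-Graph⊆Min-Epigraph
    ∘ Min-resp-≐ Cand≐Graph)
  where open Bilinear a b₁ b₂ c (suc[i]≤j⇒i<j 1≤a)
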